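{- Let $B$ be an atomless Boolean algebra and $f$ a modal operator on $B$ which is $n$-transitive for some $n\ge1$, i.e. $f^{n+1}(x)\le f^n(x)$ for all $x\in B$. If $f^n[B]$ is dense in $B$, then $f$ does not have a proper companion.
   Context: A modal operator on $B$ is $f:B\to B$ with $f(0)=0$, $f(x+y)=f(x)+f(y)$; $f^1=f$, $f^{k+1}=f\circ f^k$. A subset $Q\subseteq B$ is dense if for every $y\in B\setminus\{0\}$ there is $x\in Q\setminus\{0\}$ with $x\le y$. A companion of $f$ is a modal operator $g$ with $f(x)+g(x)=1$ for all $x\neq0$; it is proper if $g$ is not the unary discriminator (the map sending $0$ to $0$ and every nonzero element to $1$). -}

module Defs where

open import Level using (Level; _⊔_)
open import Data.Nat using (ℕ; zero; suc)
open import Data.Product using (Σ; _×_; ∃)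
open import Relation.Nullary using (¬_)
open import Algebra.Lattice.Bundles using (BooleanAlgebra)

module _ {c ℓ : Level} (B : BooleanAlgebra c ℓ) where
  open BooleanAlgebra B hiding (¬_)

  _≤ᴮ_ : Carrier → Carrier → Set ℓ
  x ≤ᴮ y = (x ∧ y) ≈ x

  Atomless : Set (c ⊔ ℓ)
  Atomless = ∀ x → ¬ (x ≈ ⊥) →
    Σ Carrier (λ y → (y ≤ᴮ x) × ¬ (y ≈ ⊥) × ¬ (y ≈ x))

  record IsModalOperator (f : Carrier → Carrier) : Set (c ⊔ ℓ) where
    field
      cong     : ∀ {x y} → x ≈ y → f x ≈ f y
      preserve-⊥ : f ⊥ ≈ ⊥
      preserve-∨ : ∀ x y → f (x ∨ y) ≈ (f x ∨ f y)

  _^[_] : (Carrier → Carrier) → ℕ → Carrier → Carrier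
  (f ^[ zero ]) x = x
  (f ^[ suc k ]) x = f ((f ^[ k ]) x)

  IsTransitive : ℕ → (Carrier → Carrier) → Set (c ⊔ ℓ)
  IsTransitive n f = ∀ x → (f ^[ suc n ]) x ≤ᴮ (f ^[ n ]) x

  Dense : ∀ {q} → (Carrier → Set q) → Set (c ⊔ ℓ ⊔ q)
  Dense Q = ∀ y → ¬ (y ≈ ⊥) → Σ Carrier (λ x → Q x × ¬ (x ≈ ⊥) × (x ≤ᴮ y))

  Image : (Carrier → Carrier) → Carrier → Set (c ⊔ ℓ)
  Image g x = Σ Carrier (λ z → x ≈ g z)

  IsCompanion : (Carrier → Carrier) → (Carrier → Carrier) → Set (c ⊔ ℓ)
  IsCompanion f g = IsModalOperator g × (∀ x → ¬ (x ≈ ⊥) → (f x ∨ g x) ≈ ⊤)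

  IsDiscriminator : (Carrier → Carrier) → Set (c ⊔ ℓ)
  IsDiscriminator g = ∀ x → ((x ≈ ⊥ → g x ≈ ⊥) × (¬ (x ≈ ⊥) → g x ≈ ⊤))

  IsProperCompanion : (Carrier → Carrier) → (Carrier → Carrier) → Set (c ⊔ ℓ)
  IsProperCompanion f g = IsCompanion f g × ¬ IsDiscriminator g

-- Let g be a companion of f and x ≠ 0. If 0 ≠ e ≤ x then g e ≤ g x, so
-- f e ∨ g e = 1 forces ¬ g x ≤ f e. Every nonzero y has a nonzero e ≤ y in
-- fⁿ[B], and n-transitivity gives f e ≤ e, hence ¬ g x ≤ y for every nonzero
-- y ≤ x. Atomlessness splits x into two disjoint nonzero parts, both above
-- ¬ g x, so ¬ g x = 0 and g x = 1: g is the unary discriminator.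
module Submission where

open import Defs
open import Level using (Level)
open import Data.Nat using (ℕ; _≥_)
open import Data.Product using (Σ; ∃; _×_; _,_)
open import Relation.Nullary using (¬_)
open import Algebra.Lattice.Bundles using (BooleanAlgebra)
import Algebra.Lattice.Properties.BooleanAlgebra as BooleanAlgebraProperties
import Algebra.Lattice.Properties.Lattice as LatticeProperties
import Relation.Binary.Lattice.Bundles as OrderTheoretic
import Relation.Binary.Reasoning.Setoid as SetoidReasoning

module BooleanAlgebraOrder {c ℓ : Level} (B : BooleanAlgebra c ℓ) where
  open BooleanAlgebra B renaming (¬_ to ∁_)
  open BooleanAlgebraProperties B using (∧-zeroˡ; ∨-identityʳ)
  open OrderTheoretic.Lattice (LatticeProperties.∨-∧-orderTheoreticLattice lattice) public
    using (_≤_; x≤x∨y; y≤x∨y; ∨-least; x∧y≤x; x∧y≤y; ∧-greatest; ≤-respˡ-≈; ≤-respʳ-≈)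
    renaming (refl to ≤-refl; trans to ≤-trans; antisym to ≤-antisym)
  open SetoidReasoning setoid

  ≤ᴮ⇒≤ : ∀ {x y} → _≤ᴮ_ B x y → x ≤ y
  ≤ᴮ⇒≤ = sym

  ⊥≤x : ∀ x → ⊥ ≤ x
  ⊥≤x x = sym (∧-zeroˡ x)

  x≤⊥⇒x≈⊥ : ∀ {x} → x ≤ ⊥ → x ≈ ⊥
  x≤⊥⇒x≈⊥ {x} x≤⊥ = ≤-antisym x≤⊥ (⊥≤x x)

  x≤y⇒x≤∁y⇒x≈⊥ : ∀ {x y} → x ≤ y → x ≤ ∁ y → x ≈ ⊥
  x≤y⇒x≤∁y⇒x≈⊥ {y = y} x≤y x≤∁y =
    x≤⊥⇒x≈⊥ (≤-respʳ-≈ (∧-complementʳ y) (∧-greatest x≤y x≤∁y))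

  x≤y⇒x∨y≈y : ∀ {x y} → x ≤ y → x ∨ y ≈ y
  x≤y⇒x∨y≈y {x} {y} x≤y = ≤-antisym (∨-least x≤y ≤-refl) (y≤x∨y x y)

  x≤y⇒∁y∧x≈⊥ : ∀ {x y} → x ≤ y → ∁ y ∧ x ≈ ⊥
  x≤y⇒∁y∧x≈⊥ {x} {y} x≤y = x≤y⇒x≤∁y⇒x≈⊥ (≤-trans (x∧y≤y (∁ y) x) x≤y) (x∧y≤x (∁ y) x)

  x≤y∨z⇒x∧z≈⊥⇒x≤y : ∀ {x y z} → x ≤ y ∨ z → x ∧ z ≈ ⊥ → x ≤ y
  x≤y∨z⇒x∧z≈⊥⇒x≤y {x} {y} {z} x≤y∨z x∧z≈⊥ = begin
    x                  ≈⟨ x≤y∨z ⟩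
    x ∧ (y ∨ z)        ≈⟨ ∧-distribˡ-∨ x y z ⟩
    (x ∧ y) ∨ (x ∧ z)  ≈⟨ ∨-congˡ x∧z≈⊥ ⟩
    (x ∧ y) ∨ ⊥        ≈⟨ ∨-identityʳ (x ∧ y) ⟩
    x ∧ y              ∎

  x≤⊤ : ∀ x → x ≤ ⊤
  x≤⊤ x = ≤-respʳ-≈ (∨-complementʳ x) (x≤x∨y x (∁ x))

  x∧∁y≈⊥⇒x≤y : ∀ {x y} → x ∧ ∁ y ≈ ⊥ → x ≤ y
  x∧∁y≈⊥⇒x≤y {x} {y} = x≤y∨z⇒x∧z≈⊥⇒x≤y (≤-respʳ-≈ (sym (∨-complementʳ y)) (x≤⊤ x))

  atomless⇒splitBelow : Atomless B → ∀ {x} → x ≉ ⊥ →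
                        ∃ λ y → y ≤ x × y ≉ ⊥ × x ∧ ∁ y ≉ ⊥
  atomless⇒splitBelow atomless {x} x≉⊥ with atomless x x≉⊥
  ... | y , y≤ᴮx , y≉⊥ , y≉x =
    y , ≤ᴮ⇒≤ y≤ᴮx , y≉⊥ ,
    λ x∧∁y≈⊥ → y≉x (≤-antisym (≤ᴮ⇒≤ y≤ᴮx) (x∧∁y≈⊥⇒x≤y x∧∁y≈⊥))

module ModalOperator {c ℓ : Level} (B : BooleanAlgebra c ℓ) where
  open BooleanAlgebra B renaming (¬_ to ∁_)
  open BooleanAlgebraOrder B

  monotone : ∀ {h} → IsModalOperator B h → ∀ {x y} → x ≤ y → h x ≤ h y
  monotone {h} isModal {x} {y} x≤y =
    ≤-respʳ-≈ (trans (sym (preserve-∨ x y)) (cong (x≤y⇒x∨y≈y x≤y))) (x≤x∨y (h x) (h y))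
    where open IsModalOperator isModal

  transitive⇒image-contracting : ∀ {f} n → IsModalOperator B f → IsTransitive B n f →
                                 ∀ {e} → Image B (_^[_] B f n) e → f e ≤ e
  transitive⇒image-contracting n isModal transitive (z , e≈fⁿz) =
    ≤-respˡ-≈ (IsModalOperator.cong isModal (sym e≈fⁿz))
      (≤-respʳ-≈ (sym e≈fⁿz) (≤ᴮ⇒≤ (transitive z)))

module Companion {c ℓ : Level} (B : BooleanAlgebra c ℓ)
  {f g : BooleanAlgebra.Carrier B → BooleanAlgebra.Carrier B}
  (companion : IsCompanion B f g) where
  open BooleanAlgebra B renaming (¬_ to ∁_)
  open BooleanAlgebraOrder B
  open ModalOperator B

  isModal-g : IsModalOperator B g
  isModal-g = let isModal , _ = companion in isModal

  f∨g≈⊤ : ∀ {x} → x ≉ ⊥ → f x ∨ g x ≈ ⊤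
  f∨g≈⊤ {x} = let _ , covers = companion in covers x

  ∁g≤f : ∀ {x e} → e ≉ ⊥ → e ≤ x → ∁ g x ≤ f e
  ∁g≤f {x} {e} e≉⊥ e≤x =
    x≤y∨z⇒x∧z≈⊥⇒x≤y (≤-respʳ-≈ (sym (f∨g≈⊤ e≉⊥)) (x≤⊤ (∁ g x)))
      (x≤y⇒∁y∧x≈⊥ (monotone isModal-g e≤x))

  module _ {q} {Q : Carrier → Set q} (dense : Dense B Q)
           (contracting : ∀ {e} → Q e → f e ≤ e) where

    ∁g≤nonzeroBelow : ∀ {x y} → y ≉ ⊥ → y ≤ x → ∁ g x ≤ y
    ∁g≤nonzeroBelow {x} {y} y≉⊥ y≤x with dense y y≉⊥
    ... | e , Qe , e≉⊥ , e≤ᴮy =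
      ≤-trans (∁g≤f e≉⊥ (≤-trans e≤y y≤x)) (≤-trans (contracting Qe) e≤y)
      where e≤y = ≤ᴮ⇒≤ e≤ᴮy

    isDiscriminator : Atomless B → IsDiscriminator B g
    isDiscriminator atomless x = g⊥ , g⊤
      where
      open SetoidReasoning setoid
      open BooleanAlgebraProperties B using (¬-involutive; ¬⊥≈⊤)

      g⊥ : x ≈ ⊥ → g x ≈ ⊥
      g⊥ x≈⊥ = trans (IsModalOperator.cong isModal-g x≈⊥) (IsModalOperator.preserve-⊥ isModal-g)

      g⊤ : x ≉ ⊥ → g x ≈ ⊤
      g⊤ x≉⊥ with atomless⇒splitBelow atomless x≉⊥
      ... | y , y≤x , y≉⊥ , x∧∁y≉⊥ = begin
        g x        ≈⟨ ¬-involutive (g x) ⟨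
        ∁ (∁ g x)  ≈⟨ ¬-cong ∁gx≈⊥ ⟩
        ∁ ⊥        ≈⟨ ¬⊥≈⊤ ⟩
        ⊤          ∎
        where
        ∁gx≈⊥ : ∁ g x ≈ ⊥
        ∁gx≈⊥ = x≤y⇒x≤∁y⇒x≈⊥ (∁g≤nonzeroBelow y≉⊥ y≤x)
          (≤-trans (∁g≤nonzeroBelow x∧∁y≉⊥ (x∧y≤x x (∁ y))) (x∧y≤y x (∁ y)))

mainTheorem19 : ∀ {c ℓ : Level} (B : BooleanAlgebra c ℓ) → Atomless B →
    (f : BooleanAlgebra.Carrier B → BooleanAlgebra.Carrier B) → IsModalOperator B f →
    (n : ℕ) → n ≥ 1 → IsTransitive B n f →
    Dense B (Image B (_^[_] B f n)) →
    ¬ Σ (BooleanAlgebra.Carrier B → BooleanAlgebra.Carrier B) (λ g → IsProperCompanion B f g)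
mainTheorem19 B atomless f isModal n _ transitive dense (g , companion , notDiscriminator) =
  notDiscriminator
    (Companion.isDiscriminator B companion dense
      (ModalOperator.transitive⇒image-contracting B n isModal transitive) atomless)
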